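{- The variety of positive S4-algebras is not locally finite, i.e. it has a finitely generated member that is infinite.
   Context: A positive S4-algebra is a structure $\langle A,\land,\lor,\Box,\Diamond,0,1\rangle$ such that $\langle A,\land,\lor,0,1\rangle$ is a bounded distributive lattice, $\Box 1=1$, $\Diamond 0=0$, and for all $a,b$: $\Box(a\land b)=\Box a\land\Box b$, $\Diamond(a\lor b)=\Diamond a\lor\Diamond b$, $\Box a\land\Diamond b\le\Diamond(a\land b)$, $\Box(a\lor b)\le\Box a\lor\Diamond b$, and $\Box\Box a=\Box a\le a\le\Diamond a=\Diamond\Diamond a$. -}

module Defs where

open import Level using (Level; suc; _⊔_)
open import Data.Nat using (ℕ)
open import Data.Fin using (Fin)
open import Data.Product using (Σ; ∃; _×_)
open import Relation.Binary.Core using (Rel)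
open import Relation.Binary.PropositionalEquality using (_≡_)
open import Algebra.Core using (Op₁; Op₂)
open import Algebra.Definitions using (Congruent₁; Identity; Zero)
open import Algebra.Lattice.Structures using (IsDistributiveLattice)

record IsPositiveS4Algebra {c ℓ} {A : Set c} (_≈_ : Rel A ℓ)
    (_∧_ _∨_ : Op₂ A) (□ ◇ : Op₁ A) (⊥ ⊤ : A) : Set (c ⊔ ℓ) where
  _≤_ : A → A → Set ℓ
  a ≤ b = (a ∧ b) ≈ a
  field
    isDistributiveLattice : IsDistributiveLattice _≈_ _∨_ _∧_
    ∨-identity-⊥ : Identity _≈_ ⊥ _∨_
    ∧-identity-⊤ : Identity _≈_ ⊤ _∧_
    □-cong : Congruent₁ _≈_ □
    ◇-cong : Congruent₁ _≈_ ◇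
    □-⊤ : □ ⊤ ≈ ⊤
    ◇-⊥ : ◇ ⊥ ≈ ⊥
    □-∧ : ∀ a b → □ (a ∧ b) ≈ (□ a ∧ □ b)
    ◇-∨ : ∀ a b → ◇ (a ∨ b) ≈ (◇ a ∨ ◇ b)
    □◇-interaction₁ : ∀ a b → (□ a ∧ ◇ b) ≤ ◇ (a ∧ b)
    □◇-interaction₂ : ∀ a b → □ (a ∨ b) ≤ (□ a ∨ ◇ b)
    □□ : ∀ a → □ (□ a) ≈ □ a
    □-deflationary : ∀ a → □ a ≤ a
    ◇-inflationary : ∀ a → a ≤ ◇ a
    ◇◇ : ∀ a → ◇ (◇ a) ≈ ◇ a

record PositiveS4Algebra c ℓ : Set (suc (c ⊔ ℓ)) where
  infixr 7 _∧_
  infixr 6 _∨_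
  infix 4 _≈_
  field
    Carrier : Set c
    _≈_ : Rel Carrier ℓ
    _∧_ _∨_ : Op₂ Carrier
    □ ◇ : Op₁ Carrier
    ⊥ ⊤ : Carrier
    isPositiveS4Algebra : IsPositiveS4Algebra _≈_ _∧_ _∨_ □ ◇ ⊥ ⊤
  open IsPositiveS4Algebra isPositiveS4Algebra public

data Term (n : ℕ) : Set where
  var : Fin n → Term n
  _∧ₜ_ _∨ₜ_ : Term n → Term n → Term n
  □ₜ ◇ₜ : Term n → Term n
  ⊥ₜ ⊤ₜ : Term n

module _ {c ℓ} (𝔸 : PositiveS4Algebra c ℓ) where
  open PositiveS4Algebra 𝔸

  eval : ∀ {n} → (Fin n → Carrier) → Term n → Carrier
  eval g (var i) = g i
  eval g (s ∧ₜ t) = eval g s ∧ eval g t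
  eval g (s ∨ₜ t) = eval g s ∨ eval g t
  eval g (□ₜ t) = □ (eval g t)
  eval g (◇ₜ t) = ◇ (eval g t)
  eval g ⊥ₜ = ⊥
  eval g ⊤ₜ = ⊤

  FinitelyGenerated : Set (c ⊔ ℓ)
  FinitelyGenerated =
    Σ ℕ λ n → Σ (Fin n → Carrier) λ g → ∀ a → Σ (Term n) λ t → eval g t ≈ a

  Infinite : Set (c ⊔ ℓ)
  Infinite = Σ (ℕ → Carrier) λ f → ∀ m n → f m ≈ f n → m ≡ n

-- Read the frame (ℕ, ≥) as a Kripke frame: □ a holds at w iff a holds at
-- every v ≤ w, and ◇ a iff a holds at some v ≤ w.  Its complex algebra of
-- (decidable) subsets of ℕ is a positive S4-algebra, and the even numbers E
-- and the odd numbers O generate infinitely many initial segments [0, k):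
-- [0, k + 1) = □ ([0, k) ∪ E) ∪ □ ([0, k) ∪ O), since whichever of E, O
-- contains k extends the segment by exactly one point, and neither contains
-- two consecutive numbers.
module Submission where

open import Defs
open import Level using (0ℓ)
open import Algebra.Bundles using (IdempotentCommutativeMonoid)
open import Algebra.Core using (Op₂)
open import Algebra.Lattice.Bundles using (RawLattice)
open import Algebra.Lattice.Structures using (IsDistributiveLattice)
open import Algebra.Lattice.Morphism.Structures using (module LatticeMorphisms)
import Algebra.Lattice.Morphism.LatticeMonomorphism as LatticeMonomorphism
import Algebra.Construct.Pointwise as Pointwise
open import Data.Bool using (Bool; true; false; T; not; _∧_; _∨_)
open import Data.Bool.Properties as Bool using (T-∧; T-∨; T-≡)
open import Data.Empty using (⊥-elim)
open import Data.Fin using (Fin; zero; suc)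
open import Data.Nat using (ℕ; zero; suc; _≤_; _<_; z≤n; s≤s)
open import Data.Nat.Properties
  using (≤-refl; ≤-trans; ≤-antisym; n≤1+n; ≮⇒≥; n≮n; m≤n⇒m<n∨m≡n; <⇒≤)
open import Data.Product using (Σ; _×_; _,_; proj₁; proj₂)
open import Data.Sum using (_⊎_; inj₁; inj₂)
open import Function using (_⇔_; mk⇔; Equivalence; _∘_)
open import Relation.Binary.Core using (Rel)
open import Relation.Binary.PropositionalEquality
  using (_≡_; _≗_; refl; sym; cong; cong₂; subst)
open import Relation.Nullary using (¬_)

open Equivalence using (to; from)

module PrefixFold {c ℓ} (M : IdempotentCommutativeMonoid c ℓ) where
  open IdempotentCommutativeMonoid M renaming (refl to ≈-refl; trans to ≈-trans)
  open import Algebra.Properties.CommutativeSemigroup commutativeSemigroup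
    using (interchange)
  open import Relation.Binary.Reasoning.Setoid setoid

  prefix : (ℕ → Carrier) → ℕ → Carrier
  prefix a zero    = a zero
  prefix a (suc w) = prefix a w ∙ a (suc w)

  prefix-cong : ∀ {a b} → (∀ w → a w ≈ b w) → ∀ w → prefix a w ≈ prefix b w
  prefix-cong a≈b zero    = a≈b zero
  prefix-cong a≈b (suc w) = ∙-cong (prefix-cong a≈b w) (a≈b (suc w))

  prefix-ε : ∀ w → prefix (λ _ → ε) w ≈ ε
  prefix-ε zero    = ≈-refl
  prefix-ε (suc w) = ≈-trans (∙-congʳ (prefix-ε w)) (identityˡ ε)

  prefix-∙ : ∀ a b w → prefix (λ v → a v ∙ b v) w ≈ prefix a w ∙ prefix b w
  prefix-∙ a b zero    = ≈-refl
  prefix-∙ a b (suc w) = begin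
    prefix (λ v → a v ∙ b v) w ∙ (a (suc w) ∙ b (suc w)) ≈⟨ ∙-congʳ (prefix-∙ a b w) ⟩
    (prefix a w ∙ prefix b w) ∙ (a (suc w) ∙ b (suc w))  ≈⟨ interchange _ _ _ _ ⟩
    prefix a (suc w) ∙ prefix b (suc w)                  ∎

  prefix-idem : ∀ a w → prefix (prefix a) w ≈ prefix a w
  prefix-idem a zero    = ≈-refl
  prefix-idem a (suc w) = begin
    prefix (prefix a) w ∙ (prefix a w ∙ a (suc w)) ≈⟨ ∙-congʳ (prefix-idem a w) ⟩
    prefix a w ∙ (prefix a w ∙ a (suc w))          ≈⟨ assoc _ _ _ ⟨
    (prefix a w ∙ prefix a w) ∙ a (suc w)          ≈⟨ ∙-congʳ (idem _) ⟩
    prefix a (suc w)                               ∎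

module AllUpTo = PrefixFold Bool.∧-idempotentCommutativeMonoid
module AnyUpTo = PrefixFold Bool.∨-idempotentCommutativeMonoid

allUpTo anyUpTo : (ℕ → Bool) → ℕ → Bool
allUpTo = AllUpTo.prefix
anyUpTo = AnyUpTo.prefix

T-allUpTo : ∀ a w → T (allUpTo a w) ⇔ (∀ {v} → v ≤ w → T (a v))
T-allUpTo a w = mk⇔ (elim w) (intro w)
  where
  elim : ∀ w → T (allUpTo a w) → ∀ {v} → v ≤ w → T (a v)
  elim zero    □a z≤n = □a
  elim (suc w) □a v≤w with m≤n⇒m<n∨m≡n v≤w | to T-∧ □a
  ... | inj₁ (s≤s v≤w′) | □a′ , _  = elim w □a′ v≤w′
  ... | inj₂ refl       | _ , aw   = aw
  intro : ∀ w → (∀ {v} → v ≤ w → T (a v)) → T (allUpTo a w)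
  intro zero    a≤w = a≤w z≤n
  intro (suc w) a≤w =
    from T-∧ (intro w (λ v≤w → a≤w (≤-trans v≤w (n≤1+n w))) , a≤w ≤-refl)

allUpTo-deflationary : ∀ a w → T (allUpTo a w) → T (a w)
allUpTo-deflationary a w □a = to (T-allUpTo a w) □a ≤-refl

anyUpTo-inflationary : ∀ a w → T (a w) → T (anyUpTo a w)
anyUpTo-inflationary a zero    aw = aw
anyUpTo-inflationary a (suc w) aw = from T-∨ (inj₂ aw)

allUpTo-anyUpTo-∧ : ∀ a b w → T (allUpTo a w) → T (anyUpTo b w) →
                    T (anyUpTo (λ v → a v ∧ b v) w)
allUpTo-anyUpTo-∧ a b zero    □a ◇b = from T-∧ (□a , ◇b)
allUpTo-anyUpTo-∧ a b (suc w) □a ◇b with to T-∧ □a | to T-∨ ◇b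
... | □a′ , _ | inj₁ ◇b′ = from T-∨ (inj₁ (allUpTo-anyUpTo-∧ a b w □a′ ◇b′))
... | _ , aw  | inj₂ bw  = from T-∨ (inj₂ (from T-∧ (aw , bw)))

allUpTo-∨ : ∀ a b w → T (allUpTo (λ v → a v ∨ b v) w) →
            T (allUpTo a w) ⊎ T (anyUpTo b w)
allUpTo-∨ a b zero    □a∨b = to T-∨ □a∨b
allUpTo-∨ a b (suc w) □a∨b with to T-∧ □a∨b
... | □a∨b′ , a∨bw with allUpTo-∨ a b w □a∨b′ | to T-∨ a∨bw
...   | inj₂ ◇b | _       = inj₂ (from T-∨ (inj₁ ◇b))
...   | inj₁ □a | inj₁ aw = inj₁ (from T-∧ (□a , aw))
...   | inj₁ _  | inj₂ bw = inj₂ (from T-∨ (inj₂ bw))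

T-⇒⇒∧≡ˡ : ∀ {x y} → (T x → T y) → x ∧ y ≡ x
T-⇒⇒∧≡ˡ {false} _   = refl
T-⇒⇒∧≡ˡ {true}  x⇒y = to T-≡ (x⇒y _)

pointwise-isDistributiveLattice :
  ∀ {i c ℓ} {I : Set i} {A : Set c} {_≈_ : Rel A ℓ} {_∨_ _∧_ : Op₂ A} →
  IsDistributiveLattice _≈_ _∨_ _∧_ →
  IsDistributiveLattice (λ f g → ∀ x → f x ≈ g x)
                        (λ f g x → f x ∨ g x) (λ f g x → f x ∧ g x)
pointwise-isDistributiveLattice {I = I} L = record
  { isLattice = record
    { isEquivalence = Pointwise.isEquivalence I isEquivalence
    ; ∨-comm        = λ f g x → ∨-comm (f x) (g x)
    ; ∨-assoc       = λ f g h x → ∨-assoc (f x) (g x) (h x)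
    ; ∨-cong        = λ f≈ g≈ x → ∨-cong (f≈ x) (g≈ x)
    ; ∧-comm        = λ f g x → ∧-comm (f x) (g x)
    ; ∧-assoc       = λ f g h x → ∧-assoc (f x) (g x) (h x)
    ; ∧-cong        = λ f≈ g≈ x → ∧-cong (f≈ x) (g≈ x)
    ; absorptive    = (λ f g x → ∨-absorbs-∧ (f x) (g x))
                    , (λ f g x → ∧-absorbs-∨ (f x) (g x))
    }
  ; ∨-distrib-∧ = (λ f g h x → ∨-distribˡ-∧ (f x) (g x) (h x))
                , (λ f g h x → ∨-distribʳ-∧ (f x) (g x) (h x))
  ; ∧-distrib-∨ = (λ f g h x → ∧-distribˡ-∨ (f x) (g x) (h x))
                , (λ f g h x → ∧-distribʳ-∨ (f x) (g x) (h x))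
  }
  where open IsDistributiveLattice L

ℕ-complexAlgebra : PositiveS4Algebra 0ℓ 0ℓ
ℕ-complexAlgebra = record
  { Carrier = ℕ → Bool
  ; _≈_     = _≗_
  ; _∧_     = λ a b w → a w ∧ b w
  ; _∨_     = λ a b w → a w ∨ b w
  ; □       = allUpTo
  ; ◇       = anyUpTo
  ; ⊥       = λ _ → false
  ; ⊤       = λ _ → true
  ; isPositiveS4Algebra = record
    { isDistributiveLattice =
        pointwise-isDistributiveLattice Bool.∨-∧-isDistributiveLattice
    ; ∨-identity-⊥    = (λ _ _ → refl) , (λ a w → Bool.∨-identityʳ (a w))
    ; ∧-identity-⊤    = (λ _ _ → refl) , (λ a w → Bool.∧-identityʳ (a w))
    ; □-cong          = AllUpTo.prefix-cong
    ; ◇-cong          = AnyUpTo.prefix-cong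
    ; □-⊤             = AllUpTo.prefix-ε
    ; ◇-⊥             = AnyUpTo.prefix-ε
    ; □-∧             = AllUpTo.prefix-∙
    ; ◇-∨             = AnyUpTo.prefix-∙
    ; □◇-interaction₁ = λ a b w → T-⇒⇒∧≡ˡ λ □a∧◇b →
        let □a , ◇b = to T-∧ □a∧◇b in allUpTo-anyUpTo-∧ a b w □a ◇b
    ; □◇-interaction₂ = λ a b w → T-⇒⇒∧≡ˡ λ □a∨b →
        from T-∨ (allUpTo-∨ a b w □a∨b)
    ; □□              = AllUpTo.prefix-idem
    ; □-deflationary  = λ a w → T-⇒⇒∧≡ˡ (allUpTo-deflationary a w)
    ; ◇-inflationary  = λ a w → T-⇒⇒∧≡ˡ (anyUpTo-inflationary a w)
    ; ◇◇              = AnyUpTo.prefix-idem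
    }
  }

-- Terms modulo equality of their values under g: the subalgebra of 𝔹
-- generated by g.
module _ {c ℓ} (𝔹 : PositiveS4Algebra c ℓ) {n}
         (g : Fin n → PositiveS4Algebra.Carrier 𝔹) where
  open PositiveS4Algebra 𝔹 renaming (_∧_ to _⊓_; _∨_ to _⊔_)
  open IsDistributiveLattice isDistributiveLattice
    using (reflexive) renaming (refl to ≈-refl)

  private
    ⟦_⟧ : Term n → Carrier
    ⟦_⟧ = eval 𝔹 g

    termLattice : RawLattice 0ℓ ℓ
    termLattice = record
      { Carrier = Term n
      ; _≈_     = λ s t → ⟦ s ⟧ ≈ ⟦ t ⟧
      ; _∧_     = _∧ₜ_
      ; _∨_     = _∨ₜ_
      }

    carrierLattice : RawLattice c ℓ
    carrierLattice = record { Carrier = Carrier ; _≈_ = _≈_ ; _∧_ = _⊓_ ; _∨_ = _⊔_ }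

    open LatticeMorphisms termLattice carrierLattice using (IsLatticeMonomorphism)

    eval-isLatticeMonomorphism : IsLatticeMonomorphism ⟦_⟧
    eval-isLatticeMonomorphism = record
      { isLatticeHomomorphism = record
        { isRelHomomorphism = record { cong = λ s≈t → s≈t }
        ; ∧-homo            = λ _ _ → ≈-refl
        ; ∨-homo            = λ _ _ → ≈-refl
        }
      ; injective = λ s≈t → s≈t
      }

  termAlgebra : PositiveS4Algebra 0ℓ ℓ
  termAlgebra = record
    { Carrier = Term n
    ; _≈_     = λ s t → ⟦ s ⟧ ≈ ⟦ t ⟧
    ; _∧_     = _∧ₜ_
    ; _∨_     = _∨ₜ_
    ; □       = □ₜ
    ; ◇       = ◇ₜ
    ; ⊥       = ⊥ₜ
    ; ⊤       = ⊤ₜ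
    ; isPositiveS4Algebra = record
      { isDistributiveLattice = LatticeMonomorphism.isDistributiveLattice
          eval-isLatticeMonomorphism isDistributiveLattice
      ; ∨-identity-⊥    = proj₁ ∨-identity-⊥ ∘ ⟦_⟧ , proj₂ ∨-identity-⊥ ∘ ⟦_⟧
      ; ∧-identity-⊤    = proj₁ ∧-identity-⊤ ∘ ⟦_⟧ , proj₂ ∧-identity-⊤ ∘ ⟦_⟧
      ; □-cong          = □-cong
      ; ◇-cong          = ◇-cong
      ; □-⊤             = □-⊤
      ; ◇-⊥             = ◇-⊥
      ; □-∧             = λ s t → □-∧ ⟦ s ⟧ ⟦ t ⟧
      ; ◇-∨             = λ s t → ◇-∨ ⟦ s ⟧ ⟦ t ⟧
      ; □◇-interaction₁ = λ s t → □◇-interaction₁ ⟦ s ⟧ ⟦ t ⟧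
      ; □◇-interaction₂ = λ s t → □◇-interaction₂ ⟦ s ⟧ ⟦ t ⟧
      ; □□              = λ t → □□ ⟦ t ⟧
      ; □-deflationary  = λ t → □-deflationary ⟦ t ⟧
      ; ◇-inflationary  = λ t → ◇-inflationary ⟦ t ⟧
      ; ◇◇              = λ t → ◇◇ ⟦ t ⟧
      }
    }

  eval-var : ∀ t → eval termAlgebra var t ≡ t
  eval-var (var i)  = refl
  eval-var (s ∧ₜ t) = cong₂ _∧ₜ_ (eval-var s) (eval-var t)
  eval-var (s ∨ₜ t) = cong₂ _∨ₜ_ (eval-var s) (eval-var t)
  eval-var (□ₜ t)   = cong □ₜ (eval-var t)
  eval-var (◇ₜ t)   = cong ◇ₜ (eval-var t)
  eval-var ⊥ₜ       = refl
  eval-var ⊤ₜ       = refl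

  termAlgebra-finitelyGenerated : FinitelyGenerated termAlgebra
  termAlgebra-finitelyGenerated = n , var , λ t → t , reflexive (cong ⟦_⟧ (eval-var t))

even odd : ℕ → Bool
even zero    = true
even (suc n) = not (even n)
odd n = not (even n)

evenOdd : Fin 2 → ℕ → Bool
evenOdd zero       = even
evenOdd (suc zero) = odd

⟦_⟧ : Term 2 → ℕ → Bool
⟦_⟧ = eval ℕ-complexAlgebra evenOdd

T-not-T : ∀ x → T x → ¬ T (not x)
T-not-T true _ ()

module _ {s : ℕ → Bool} {k : ℕ} (s-segment : ∀ v → T (s v) ⇔ v < k) where

  allUpTo-extends-segment : ∀ {c : ℕ → Bool} {w} → T (c k) → w ≤ k →
                            T (allUpTo (λ v → s v ∨ c v) w)
  allUpTo-extends-segment {c} {w} ck w≤k = from (T-allUpTo (λ v → s v ∨ c v) w) λ {v} v≤w →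
    from (T-∨ {s v}) (s∨c (m≤n⇒m<n∨m≡n (≤-trans v≤w w≤k)))
    where
    s∨c : ∀ {v} → v < k ⊎ v ≡ k → T (s v) ⊎ T (c v)
    s∨c (inj₁ v<k)  = inj₁ (from (s-segment _) v<k)
    s∨c (inj₂ refl) = inj₂ ck

  allUpTo-within-segment : ∀ {c : ℕ → Bool} {w} → (∀ v → T (c v) → ¬ T (c (suc v))) →
                           T (allUpTo (λ v → s v ∨ c v) w) → w ≤ k
  allUpTo-within-segment {c} {w} alternating □s∨c = ≮⇒≥ λ k<w →
    alternating k (c-at ≤-refl (<⇒≤ k<w)) (c-at (n≤1+n k) k<w)
    where
    c-at : ∀ {v} → k ≤ v → v ≤ w → T (c v)
    c-at {v} k≤v v≤w with to (T-∨ {s v}) (to (T-allUpTo (λ v → s v ∨ c v) w) □s∨c v≤w)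
    ... | inj₁ sv = ⊥-elim (n≮n v (≤-trans (to (s-segment v) sv) k≤v))
    ... | inj₂ cv = cv

chain : ℕ → Term 2
chain zero    = ⊥ₜ
chain (suc k) = □ₜ (chain k ∨ₜ var zero) ∨ₜ □ₜ (chain k ∨ₜ var (suc zero))

⟦chain⟧ : ∀ k w → T (⟦ chain k ⟧ w) ⇔ w < k
⟦chain⟧ zero    w = mk⇔ (λ ()) (λ ())
⟦chain⟧ (suc k) w = mk⇔ within extends
  where
  within : T (⟦ chain (suc k) ⟧ w) → w < suc k
  within □∨□ with to T-∨ □∨□
  ... | inj₁ □even = s≤s (allUpTo-within-segment (⟦chain⟧ k) (T-not-T ∘ even) □even)
  ... | inj₂ □odd  = s≤s (allUpTo-within-segment (⟦chain⟧ k) (T-not-T ∘ odd) □odd)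
  extends : w < suc k → T (⟦ chain (suc k) ⟧ w)
  extends (s≤s w≤k) with even k in even-k
  ... | true  = from T-∨ (inj₁
    (allUpTo-extends-segment (⟦chain⟧ k) (subst T (sym even-k) _) w≤k))
  ... | false = from T-∨ (inj₂
    (allUpTo-extends-segment (⟦chain⟧ k) (subst (T ∘ not) (sym even-k) _) w≤k))

chain-injective : ∀ m n → ⟦ chain m ⟧ ≗ ⟦ chain n ⟧ → m ≡ n
chain-injective m n eq = ≤-antisym (bounded m n eq) (bounded n m (sym ∘ eq))
  where
  bounded : ∀ m n → ⟦ chain m ⟧ ≗ ⟦ chain n ⟧ → m ≤ n
  bounded m n eq = ≮⇒≥ λ n<m →
    n≮n n (to (⟦chain⟧ n n) (subst T (eq n) (from (⟦chain⟧ m n) n<m)))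

corollary5p4 : Σ (PositiveS4Algebra Level.zero Level.zero) λ 𝔸 → FinitelyGenerated 𝔸 × Infinite 𝔸
corollary5p4 =
  termAlgebra ℕ-complexAlgebra evenOdd ,
  termAlgebra-finitelyGenerated ℕ-complexAlgebra evenOdd ,
  chain , chain-injective
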